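{- Let $T$ be a rooted tree with $n$ leaves such that for every node $v$, the height of the subtree of $T$ rooted at $v$ is at most $\log_2 m$, where $m$ is the number of leaves of that subtree. Then $\sum_{v\in V(T)}\mathsf{height}(v)=O(n)$, where $\mathsf{height}(v)$ is the height of the subtree rooted at $v$. -}

module Defs where

open import Data.Nat using (ℕ; zero; suc; _+_; _^_; _≤_; _⊔_)
open import Data.List using (List; []; _∷_)
open import Data.List.Relation.Unary.All using (All)

data Tree : Set where
  node : List Tree → Tree

mutual
  height : Tree → ℕ
  height (node ts) = heightF ts

  heightF : List Tree → ℕ
  heightF []       = 0
  heightF (t ∷ ts) = suc (maxHeight (t ∷ ts))

  maxHeight : List Tree → ℕ
  maxHeight []       = 0
  maxHeight (t ∷ ts) = height t ⊔ maxHeight ts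

mutual
  leaves : Tree → ℕ
  leaves (node []) = 1
  leaves (node (t ∷ ts)) = leavesL (t ∷ ts)

  leavesL : List Tree → ℕ
  leavesL []       = 0
  leavesL (t ∷ ts) = leaves t + leavesL ts

mutual
  sumHeights : Tree → ℕ
  sumHeights (node ts) = height (node ts) + sumHeightsL ts

  sumHeightsL : List Tree → ℕ
  sumHeightsL []       = 0
  sumHeightsL (t ∷ ts) = sumHeights t + sumHeightsL ts

-- height(v) ≤ log₂ m(v) at every node v, where m(v) is the number of leaves
-- of the subtree rooted at v.  Since height is a natural number,
-- h ≤ log₂ m  ⇔  2 ^ h ≤ m.
data Balanced : Tree → Set where
  bal : ∀ {ts} → 2 ^ height (node ts) ≤ leaves (node ts) → All Balanced ts → Balanced (node ts)

{-# OPTIONS --safe #-}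
-- Induct on the stronger invariant  2^h·S + (h+2)·m ≤ 2^(h+1)·m,  i.e.
-- S ≤ 2m − (h+2)m/2^h, for a forest of height at most h with height sum S and
-- m leaves.  It is additive over siblings once they are padded to a common
-- height (padding only weakens it), and passing to the parent adds h+1 to S,
-- which is at most (h+1)m/2^(h+1) by balance and is absorbed by the slack term.
-- Dropping the slack gives S ≤ 2m.
module Submission where

open import Defs
open import Data.Nat using (ℕ; suc; _+_; _*_; _^_; _≤_; _≤′_; ≤′-refl; ≤′-step; z≤n; s≤s)
open import Data.Nat.Properties
open import Data.Nat.Tactic.RingSolver using (solve-∀)
open import Data.Product using (∃-syntax; _,_)
open import Data.List using ([]; _∷_)
open import Data.List.Relation.Unary.All using (All; []; _∷_)
open import Relation.Binary.PropositionalEquality using (_≡_; sym)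

record HeightSumBound (h S m : ℕ) : Set where
  constructor heightSumBound
  field
    inequality : 2 ^ h * S + (2 + h) * m ≤ 2 ^ suc h * m

HeightSumBound-zero : ∀ h → HeightSumBound h 0 0
HeightSumBound-zero h = heightSumBound (≤-reflexive (annihilate (2 ^ h) h))
  where
  annihilate : ∀ a h → a * 0 + (2 + h) * 0 ≡ 2 * a * 0
  annihilate = solve-∀

HeightSumBound-doubling : ∀ {h S m} S′ → 2 ^ suc h * S′ + (3 + h) * m ≤ 2 * (2 ^ h * S + (2 + h) * m) →
                          HeightSumBound h S m → HeightSumBound (suc h) S′ m
HeightSumBound-doubling {h} {S} {m} S′ ≤2lhs (heightSumBound bound) = heightSumBound (begin
  2 ^ suc h * S′ + (3 + h) * m     ≤⟨ ≤2lhs ⟩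
  2 * (2 ^ h * S + (2 + h) * m)    ≤⟨ *-monoʳ-≤ 2 bound ⟩
  2 * (2 ^ suc h * m)              ≡⟨ sym (*-assoc 2 (2 ^ suc h) m) ⟩
  2 ^ suc (suc h) * m              ∎)
  where open ≤-Reasoning

HeightSumBound-suc : ∀ {h S m} → HeightSumBound h S m → HeightSumBound (suc h) S m
HeightSumBound-suc {h} {S} {m} = HeightSumBound-doubling _ (begin
  2 ^ suc h * S + (3 + h) * m          ≤⟨ +-monoʳ-≤ (2 ^ suc h * S) (*-monoˡ-≤ m 3+h≤2[2+h]) ⟩
  2 ^ suc h * S + (2 * (2 + h)) * m    ≡⟨ factor (2 ^ h) S h m ⟩
  2 * (2 ^ h * S + (2 + h) * m)        ∎)
  where
  open ≤-Reasoning
  3+h≤2[2+h] : 3 + h ≤ 2 * (2 + h)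
  3+h≤2[2+h] = ≤-trans (m≤m+n (3 + h) (1 + h)) (≤-reflexive (double h))
    where
    double : ∀ h → 3 + h + (1 + h) ≡ 2 * (2 + h)
    double = solve-∀
  factor : ∀ a S h m → 2 * a * S + (2 * (2 + h)) * m ≡ 2 * (a * S + (2 + h) * m)
  factor = solve-∀

HeightSumBound-mono : ∀ {h h′ S m} → h ≤′ h′ → HeightSumBound h S m → HeightSumBound h′ S m
HeightSumBound-mono ≤′-refl          bound = bound
HeightSumBound-mono (≤′-step h≤′h′) bound = HeightSumBound-suc (HeightSumBound-mono h≤′h′ bound)

HeightSumBound-+ : ∀ {h S m S′ m′} → HeightSumBound h S m → HeightSumBound h S′ m′ →
                   HeightSumBound h (S + S′) (m + m′)
HeightSumBound-+ {h} {S} {m} {S′} {m′} (heightSumBound bound) (heightSumBound bound′) = heightSumBound (begin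
  2 ^ h * (S + S′) + (2 + h) * (m + m′)                         ≡⟨ regroup (2 ^ h) S S′ h m m′ ⟩
  (2 ^ h * S + (2 + h) * m) + (2 ^ h * S′ + (2 + h) * m′)     ≤⟨ +-mono-≤ bound bound′ ⟩
  2 ^ suc h * m + 2 ^ suc h * m′                                ≡⟨ sym (*-distribˡ-+ (2 ^ suc h) m m′) ⟩
  2 ^ suc h * (m + m′)                                          ∎)
  where
  open ≤-Reasoning
  regroup : ∀ a S S′ h m m′ →
            a * (S + S′) + (2 + h) * (m + m′) ≡ (a * S + (2 + h) * m) + (a * S′ + (2 + h) * m′)
  regroup = solve-∀

HeightSumBound-parent : ∀ {h S m} → 2 ^ suc h ≤ m → HeightSumBound h S m →
                        HeightSumBound (suc h) (suc h + S) m
HeightSumBound-parent {h} {S} {m} balanced = HeightSumBound-doubling _ (begin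
  2 ^ suc h * (suc h + S) + (3 + h) * m              ≡⟨ expand (2 ^ h) h S m ⟩
  2 ^ suc h * suc h + (3 + h) * m + 2 ^ suc h * S    ≤⟨ +-monoˡ-≤ _ (+-monoˡ-≤ _ (*-monoˡ-≤ (suc h) balanced)) ⟩
  m * suc h + (3 + h) * m + 2 ^ suc h * S            ≡⟨ collect (2 ^ h) h S m ⟩
  2 * (2 ^ h * S + (2 + h) * m)                      ∎)
  where
  open ≤-Reasoning
  expand : ∀ a h S m → 2 * a * (suc h + S) + (3 + h) * m ≡ 2 * a * suc h + (3 + h) * m + 2 * a * S
  expand = solve-∀
  collect : ∀ a h S m → m * suc h + (3 + h) * m + 2 * a * S ≡ 2 * (a * S + (2 + h) * m)
  collect = solve-∀

HeightSumBound⇒≤2* : ∀ {h S m} → HeightSumBound h S m → S ≤ 2 * m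
HeightSumBound⇒≤2* {h} {S} {m} (heightSumBound bound) = *-cancelˡ-≤ (2 ^ h) {{m^n≢0 2 h}} (begin
  2 ^ h * S                    ≤⟨ m≤m+n (2 ^ h * S) _ ⟩
  2 ^ h * S + (2 + h) * m      ≤⟨ bound ⟩
  2 * 2 ^ h * m                ≡⟨ swap (2 ^ h) m ⟩
  2 ^ h * (2 * m)              ∎)
  where
  open ≤-Reasoning
  swap : ∀ a m → 2 * a * m ≡ a * (2 * m)
  swap = solve-∀

mutual
  balanced⇒HeightSumBound : ∀ T → Balanced T → HeightSumBound (height T) (sumHeights T) (leaves T)
  balanced⇒HeightSumBound (node [])       (bal _ _)               = heightSumBound (s≤s (s≤s z≤n))
  balanced⇒HeightSumBound (node (t ∷ ts)) (bal balanced children) =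
    HeightSumBound-parent balanced (balanced⇒HeightSumBoundᶠ (t ∷ ts) children ≤-refl)

  balanced⇒HeightSumBoundᶠ : ∀ ts → All Balanced ts → ∀ {h} → maxHeight ts ≤ h →
                             HeightSumBound h (sumHeightsL ts) (leavesL ts)
  balanced⇒HeightSumBoundᶠ []       []         {h} _ = HeightSumBound-zero h
  balanced⇒HeightSumBoundᶠ (t ∷ ts) (bt ∷ bts)     maxHeight≤h =
    HeightSumBound-+
      (HeightSumBound-mono (≤⇒≤′ (m⊔n≤o⇒m≤o (height t) (maxHeight ts) maxHeight≤h))
                           (balanced⇒HeightSumBound t bt))
      (balanced⇒HeightSumBoundᶠ ts bts (m⊔n≤o⇒n≤o (height t) (maxHeight ts) maxHeight≤h))

sumHeights≤2*leaves : ∀ T → Balanced T → sumHeights T ≤ 2 * leaves T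
sumHeights≤2*leaves T balanced = HeightSumBound⇒≤2* (balanced⇒HeightSumBound T balanced)

lemma10 : ∃[ C ] ((T : Tree) → Balanced T → sumHeights T ≤ C * leaves T)
lemma10 = 2 , sumHeights≤2*leaves
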